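{- There is some $d_0$ such that the following holds for each $d\geq d_0$. Let $G$ be a bipartite graph with vertex classes $A$ and $B$, with $|A|\geq |B|$, such that $d_G(x,y)\leq d^{1/5}$ for all distinct $x,y\in B$, $d(x)\leq d$ for each $x\in A$, and $d(G)\geq d^{3/4}$. Then $G$ contains a $C_4$-free subgraph with average degree at least $d^{1/4}$.
   Context: $d(G)=2e(G)/|V(G)|$ is the average degree, $d(x)$ is the degree of vertex $x$, and the codegree $d_G(x,y)$ is the number of common neighbours of $x$ and $y$ in $G$. A graph is $C_4$-free if it contains no cycle of length $4$.
   Formalization: The parameter d ranges only over the rationals. -}

module Defs where

open import Data.Nat using (ℕ; zero; suc; _+_; _*_)
open import Data.Bool using (Bool; true; false; _∧_; _∨_)
open import Data.Fin using (Fin; zero; suc)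
open import Data.Integer using (+_)
open import Data.Rational using (ℚ; _/_) renaming (_*_ to _*q_; 1ℚ to 1q)
open import Data.Product using (Σ; _×_; ∃)
open import Relation.Binary.PropositionalEquality using (_≡_; _≢_)
open import Relation.Nullary using (¬_)

ℕ→ℚ : ℕ → ℚ
ℕ→ℚ n = (+ n) / 1

_^q_ : ℚ → ℕ → ℚ
q ^q zero = 1q
q ^q suc k = q *q (q ^q k)

sumFin : (n : ℕ) → (Fin n → ℕ) → ℕ
sumFin zero f = 0
sumFin (suc n) f = f zero + sumFin n (λ i → f (suc i))

b2n : Bool → ℕ
b2n true = 1
b2n false = 0

-- A bipartite graph with vertex classes A = Fin a and B = Fin b,
-- given by its (decidable) adjacency relation between A and B.
BipGraph : ℕ → ℕ → Set
BipGraph a b = Fin a → Fin b → Bool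

edges : ∀ {a b} → BipGraph a b → ℕ
edges {a} {b} E = sumFin a (λ x → sumFin b (λ y → b2n (E x y)))

degA : ∀ {a b} → BipGraph a b → Fin a → ℕ
degA {a} {b} E x = sumFin b (λ y → b2n (E x y))

codegB : ∀ {a b} → BipGraph a b → Fin b → Fin b → ℕ
codegB {a} {b} E y y' = sumFin a (λ x → b2n (E x y ∧ E x y'))

record Subgraph {a b : ℕ} (G : BipGraph a b) : Set where
  field
    VA : Fin a → Bool
    VB : Fin b → Bool
    F  : BipGraph a b
    F⊆G : ∀ x y → F x y ≡ true → G x y ≡ true
    F⊆V : ∀ x y → F x y ≡ true → (VA x ≡ true) × (VB y ≡ true)

open Subgraph public

vertsH : ∀ {a b} {G : BipGraph a b} → Subgraph G → ℕ
vertsH {a} {b} H = sumFin a (λ x → b2n (VA H x)) + sumFin b (λ y → b2n (VB H y))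

edgesH : ∀ {a b} {G : BipGraph a b} → Subgraph G → ℕ
edgesH H = edges (F H)

-- C4-free: a bipartite graph contains a 4-cycle iff there are distinct
-- x, x' ∈ A and distinct y, y' ∈ B with all four edges xy, xy', x'y, x'y'.
C4Free : ∀ {a b} → BipGraph a b → Set
C4Free {a} {b} E =
  ¬ (Σ (Fin a) λ x → Σ (Fin a) λ x' → Σ (Fin b) λ y → Σ (Fin b) λ y' →
       x ≢ x' × y ≢ y' ×
       E x y ≡ true × E x y' ≡ true × E x' y ≡ true × E x' y' ≡ true)

-- Let e = e(G) and N = ⌊d⌋. Counting the 4-cycles x y x′ y′ of G through their paths y x y′ and using
-- d(x) ≤ N, d(y, y′) ≤ K = ⌊N^{1/5}⌋ gives at most q ≤ e N K labelled 4-cycles. Repeatedly deleting an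
-- edge that lies on the most remaining 4-cycles derandomises the deletion method: the C₄-free graph H
-- that is left has, for every s ≤ e, at least s − q (s)₄/(e)₄ edges, the number that survives on average
-- when a random s-set of edges loses one edge per 4-cycle it contains. For s ≈ 2e/√N this loss is at most
-- s/2, so e(H)² ≥ e²/N (a single edge does when e² ≤ N), and the density hypothesis turns this into d(H)⁴ ≥ d.
module Submission where

open import Defs
open import Data.Nat
open import Data.Nat.Properties
open import Data.Nat.Combinatorics.Base using (_P′_)
open import Data.Nat.DivMod using (m*n/n≡m; /-monoˡ-≤; m/n*n≤m)
open import Data.Nat.Coprimality as Coprime using (Coprime; 1-coprimeTo)
open import Data.Nat.Tactic.RingSolver using (solve-∀)
open import Algebra.Properties.CommutativeSemiring.Exp +-*-commutativeSemiring using (^-distrib-*)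
import Data.Integer as ℤ
import Data.Integer.Properties as ℤP
open import Data.Rational using (ℚ) renaming (_≤_ to _≤q_; _*_ to _*q_)
open import Data.Rational as ℚ using (mkℚ; *≤*; Positive; NonNegative)
import Data.Rational.Properties as ℚP
open import Data.Bool using (Bool; true; false; not; _∧_)
open import Data.Bool.Properties using (∧-conicalˡ; ∧-conicalʳ)
open import Data.Fin using (Fin; zero; suc)
open import Data.Fin.Properties using () renaming (_≟_ to _≟ᶠ_)
open import Data.Product using (Σ; Σ-syntax; ∃-syntax; _×_; _,_; proj₁; proj₂)
open import Data.Sum using (inj₁; inj₂)
open import Data.Empty using (⊥-elim)
open import Function using (_∘_; id)
open import Relation.Binary.PropositionalEquality
open import Relation.Nullary using (¬_; does; yes; no; contradiction)
open import Relation.Nullary.Decidable using (dec-false)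
open import Relation.Unary using (Decidable)

sumFin-cong : ∀ n {f g : Fin n → ℕ} → (∀ i → f i ≡ g i) → sumFin n f ≡ sumFin n g
sumFin-cong zero    f≗g = refl
sumFin-cong (suc n) f≗g = cong₂ _+_ (f≗g zero) (sumFin-cong n (f≗g ∘ suc))

sumFin-mono : ∀ n {f g : Fin n → ℕ} → (∀ i → f i ≤ g i) → sumFin n f ≤ sumFin n g
sumFin-mono zero    f≤g = z≤n
sumFin-mono (suc n) f≤g = +-mono-≤ (f≤g zero) (sumFin-mono n (f≤g ∘ suc))

sumFin-zero : ∀ n → sumFin n (λ _ → 0) ≡ 0
sumFin-zero zero    = refl
sumFin-zero (suc n) = sumFin-zero n

sumFin-one : ∀ n → sumFin n (λ _ → 1) ≡ n
sumFin-one zero    = refl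
sumFin-one (suc n) = cong suc (sumFin-one n)

sumFin-distrib-+ : ∀ n (f g : Fin n → ℕ) →
                   sumFin n (λ i → f i + g i) ≡ sumFin n f + sumFin n g
sumFin-distrib-+ zero    f g = refl
sumFin-distrib-+ (suc n) f g = begin
  f zero + g zero + sumFin n (λ i → f (suc i) + g (suc i))
    ≡⟨ cong (f zero + g zero +_) (sumFin-distrib-+ n (f ∘ suc) (g ∘ suc)) ⟩
  f zero + g zero + (sumFin n (f ∘ suc) + sumFin n (g ∘ suc))
    ≡⟨ +-assoc-interchange (f zero) (g zero) _ _ ⟩
  f zero + sumFin n (f ∘ suc) + (g zero + sumFin n (g ∘ suc)) ∎
  where
  open ≡-Reasoning
  +-assoc-interchange : ∀ a b c d → a + b + (c + d) ≡ a + c + (b + d)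
  +-assoc-interchange = solve-∀

*-distribˡ-sumFin : ∀ n c (f : Fin n → ℕ) → c * sumFin n f ≡ sumFin n (λ i → c * f i)
*-distribˡ-sumFin zero    c f = *-zeroʳ c
*-distribˡ-sumFin (suc n) c f =
  trans (*-distribˡ-+ c (f zero) _) (cong (c * f zero +_) (*-distribˡ-sumFin n c (f ∘ suc)))

*-distribˡ-sumFin₂ : ∀ m n c (f : Fin m → Fin n → ℕ) →
  c * sumFin m (λ i → sumFin n (f i)) ≡ sumFin m λ i → sumFin n λ j → c * f i j
*-distribˡ-sumFin₂ m n c f =
  trans (*-distribˡ-sumFin m c _) (sumFin-cong m λ i → *-distribˡ-sumFin n c (f i))

*-distribʳ-sumFin : ∀ n c (f : Fin n → ℕ) → sumFin n f * c ≡ sumFin n (λ i → f i * c)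
*-distribʳ-sumFin n c f =
  trans (*-comm (sumFin n f) c) (trans (*-distribˡ-sumFin n c f) (sumFin-cong n (λ i → *-comm c (f i))))

sumFin-comm : ∀ m n (f : Fin m → Fin n → ℕ) →
              sumFin m (λ i → sumFin n (f i)) ≡ sumFin n (λ j → sumFin m (λ i → f i j))
sumFin-comm zero    n f = sym (sumFin-zero n)
sumFin-comm (suc m) n f =
  trans (cong (sumFin n (f zero) +_) (sumFin-comm m n (f ∘ suc)))
        (sym (sumFin-distrib-+ n (f zero) _))

≤-sumFin : ∀ n (f : Fin n → ℕ) i → f i ≤ sumFin n f
≤-sumFin (suc n) f zero    = m≤m+n _ _
≤-sumFin (suc n) f (suc i) = ≤-trans (≤-sumFin n (f ∘ suc) i) (m≤n+m _ _)

sumFin-pos : ∀ n (f : Fin n → ℕ) → 0 < sumFin n f → ∃[ i ] 0 < f i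
sumFin-pos (suc n) f pos with f zero in f₀≡
... | suc _ = zero , subst (0 <_) (sym f₀≡) z<s
... | zero  = let i , fᵢ>0 = sumFin-pos n (f ∘ suc) pos in suc i , fᵢ>0

argmax : ∀ {n} (f : Fin n → ℕ) → Fin n → ∃[ i ] ∀ j → f j ≤ f i
argmax {suc zero}    f _ = zero , λ { zero → ≤-refl }
argmax {suc (suc n)} f _ with argmax (f ∘ suc) zero
... | i , max with f zero ≤? f (suc i)
...   | yes f₀≤ = suc i , λ { zero → f₀≤ ; (suc j) → max j }
...   | no  f₀≰ = zero  , λ { zero → ≤-refl ; (suc j) → ≤-trans (max j) (<⇒≤ (≰⇒> f₀≰)) }

argmax₂ : ∀ {m n} (f : Fin m → Fin n → ℕ) → Fin m → Fin n → ∃[ i ] ∃[ j ] ∀ i′ j′ → f i′ j′ ≤ f i j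
argmax₂ f i₀ j₀ =
  let rowMax i = proj₁ (argmax (f i) j₀)
      i , best = argmax (λ i → f i (rowMax i)) i₀
  in i , rowMax i , λ i′ j′ → ≤-trans (proj₂ (argmax (f i′) j₀) j′) (best i′)

_==_ : ∀ {n} → Fin n → Fin n → Bool
i == j = does (i ≟ᶠ j)

==-sym : ∀ {n} (i j : Fin n) → (i == j) ≡ (j == i)
==-sym i j with i ≟ᶠ j | j ≟ᶠ i
... | yes _   | yes _   = refl
... | no  _   | no  _   = refl
... | yes i≡j | no  j≢i = ⊥-elim (j≢i (sym i≡j))
... | no  i≢j | yes j≡i = ⊥-elim (i≢j (sym j≡i))

==⇒≡ : ∀ {n} {i j : Fin n} → (i == j) ≡ true → i ≡ j
==⇒≡ {i = i} {j} i==j with i ≟ᶠ j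
... | yes i≡j = i≡j
==⇒≡ () | no _

sumFin-δ : ∀ n (k : Fin n) (f : Fin n → ℕ) → sumFin n (λ i → b2n (i == k) * f i) ≡ f k
sumFin-δ (suc n) zero    f = trans (cong (f zero + 0 +_) (sumFin-zero n)) (trans (+-identityʳ _) (+-identityʳ _))
sumFin-δ (suc n) (suc k) f = sumFin-δ n k (f ∘ suc)

sumFin₂-δ : ∀ m n (i₀ : Fin m) (j₀ : Fin n) (f : Fin m → Fin n → ℕ) →
  sumFin m (λ i → sumFin n λ j → b2n (i == i₀) * (b2n (j == j₀) * f i j)) ≡ f i₀ j₀
sumFin₂-δ m n i₀ j₀ f =
  trans (sumFin-cong m λ i → trans (sym (*-distribˡ-sumFin n (b2n (i == i₀)) _))
                                   (cong (b2n (i == i₀) *_) (sumFin-δ n j₀ (f i))))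
        (sumFin-δ m i₀ (λ i → f i j₀))

b2n*-pos : ∀ {e} n → 0 < b2n e * n → e ≡ true
b2n*-pos {true} _ _ = refl

b2n*≤ : ∀ p n → b2n p * n ≤ n
b2n*≤ true  n = ≤-reflexive (+-identityʳ n)
b2n*≤ false n = z≤n

b2n-∧ : ∀ p q → b2n (p ∧ q) ≡ b2n p * b2n q
b2n-∧ true  q = sym (+-identityʳ (b2n q))
b2n-∧ false q = refl

==-exclusive : ∀ {n} {i j : Fin n} k → i ≢ j → (i == k ∧ j == k) ≡ false
==-exclusive {i = i} {j} k i≢j with i ≟ᶠ k | j ≟ᶠ k
... | yes refl | yes refl = ⊥-elim (i≢j refl)
... | yes _    | no _     = refl
... | no _     | _        = refl

survivors+hits≡1 : ∀ p p′ q q′ → (p ∧ p′) ≡ false → (q ∧ q′) ≡ false →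
  b2n (not (p ∧ q)) * b2n (not (p ∧ q′)) * (b2n (not (p′ ∧ q)) * b2n (not (p′ ∧ q′)))
    + (b2n p * b2n q + b2n p * b2n q′ + (b2n p′ * b2n q + b2n p′ * b2n q′)) ≡ 1
survivors+hits≡1 true  true  _     _     () _
survivors+hits≡1 _     _     true  true  _  ()
survivors+hits≡1 true  false true  false _  _ = refl
survivors+hits≡1 true  false false true  _  _ = refl
survivors+hits≡1 true  false false false _  _ = refl
survivors+hits≡1 false true  true  false _  _ = refl
survivors+hits≡1 false true  false true  _  _ = refl
survivors+hits≡1 false true  false false _  _ = refl
survivors+hits≡1 false false true  false _  _ = refl
survivors+hits≡1 false false false true  _  _ = refl
survivors+hits≡1 false false false false _  _ = refl

module _ {a b : ℕ} where

  _⊆_ : BipGraph a b → BipGraph a b → Set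
  H ⊆ E = ∀ x y → H x y ≡ true → E x y ≡ true

  adj : BipGraph a b → Fin a → Fin b → ℕ
  adj E x y = b2n (E x y)

  Σ₄ : (Fin a → Fin a → Fin b → Fin b → ℕ) → ℕ
  Σ₄ f = sumFin a λ x → sumFin a λ x′ → sumFin b λ y → sumFin b λ y′ → f x x′ y y′

  -- 1 if x y x′ y′ is a 4-cycle (x ≠ x′ in A, y ≠ y′ in B), so `cycles` counts each 4-cycle 4 times.
  cycleAt : BipGraph a b → Fin a → Fin a → Fin b → Fin b → ℕ
  cycleAt E x x′ y y′ =
    b2n (not (x == x′)) * b2n (not (y == y′)) * (adj E x y * adj E x y′ * (adj E x′ y * adj E x′ y′))

  cycles : BipGraph a b → ℕ
  cycles E = Σ₄ (cycleAt E)

  cyclesThrough : BipGraph a b → Fin a → Fin b → ℕ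
  cyclesThrough E x y = sumFin a λ x′ → sumFin b λ y′ → cycleAt E x x′ y y′

  onEdge : Fin a → Fin b → Fin a → Fin b → ℕ → ℕ
  onEdge x₀ y₀ x y n = b2n (x == x₀) * (b2n (y == y₀) * n)

  removeEdge : BipGraph a b → Fin a → Fin b → BipGraph a b
  removeEdge E x₀ y₀ x y = E x y ∧ not (x == x₀ ∧ y == y₀)

  Σ₄-cong : ∀ {f g} → (∀ x x′ y y′ → f x x′ y y′ ≡ g x x′ y y′) → Σ₄ f ≡ Σ₄ g
  Σ₄-cong f≗g = sumFin-cong a λ x → sumFin-cong a λ x′ → sumFin-cong b λ y → sumFin-cong b λ y′ → f≗g x x′ y y′

  Σ₄-distrib-+ : ∀ f g → Σ₄ (λ x x′ y y′ → f x x′ y y′ + g x x′ y y′) ≡ Σ₄ f + Σ₄ g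
  Σ₄-distrib-+ f g =
    trans (sumFin-cong a λ x →
            trans (sumFin-cong a λ x′ →
                    trans (sumFin-cong b λ y → sumFin-distrib-+ b _ _) (sumFin-distrib-+ b _ _))
                  (sumFin-distrib-+ a _ _))
          (sumFin-distrib-+ a _ _)

  Σ₄-swapᴬ : ∀ f → Σ₄ f ≡ Σ₄ (λ x x′ y y′ → f x′ x y y′)
  Σ₄-swapᴬ f = sumFin-comm a a _

  Σ₄-swapᴮ : ∀ f → Σ₄ f ≡ Σ₄ (λ x x′ y y′ → f x x′ y′ y)
  Σ₄-swapᴮ f = sumFin-cong a λ x → sumFin-cong a λ x′ → sumFin-comm b b _

  Σ₄-byEdge : ∀ f → Σ₄ f ≡ sumFin a λ x → sumFin b λ y → sumFin a λ x′ → sumFin b λ y′ → f x x′ y y′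
  Σ₄-byEdge f = sumFin-cong a λ x → sumFin-comm a b _

  Σ₄-δ : ∀ x₀ y₀ (f : Fin a → Fin a → Fin b → Fin b → ℕ) →
    Σ₄ (λ x x′ y y′ → onEdge x₀ y₀ x y (f x x′ y y′))
      ≡ sumFin a λ x′ → sumFin b λ y′ → f x₀ x′ y₀ y′
  Σ₄-δ x₀ y₀ f =
    trans (Σ₄-byEdge _)
      (trans (sumFin-cong a λ x → sumFin-cong b λ y →
               trans (sym (*-distribˡ-sumFin₂ a b (b2n (x == x₀)) _))
                     (cong (b2n (x == x₀) *_) (sym (*-distribˡ-sumFin₂ a b (b2n (y == y₀)) (λ x′ y′ → f x x′ y y′)))))
             (sumFin₂-δ a b x₀ y₀ (λ x y → sumFin a λ x′ → sumFin b λ y′ → f x x′ y y′)))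

  cycleAt-swapᴬ : ∀ E x x′ y y′ → cycleAt E x x′ y y′ ≡ cycleAt E x′ x y y′
  cycleAt-swapᴬ E x x′ y y′ =
    cong₂ _*_ (cong (λ p → b2n (not p) * b2n (not (y == y′))) (==-sym x x′))
              (*-comm (adj E x y * adj E x y′) (adj E x′ y * adj E x′ y′))

  cycleAt-swapᴮ : ∀ E x x′ y y′ → cycleAt E x x′ y y′ ≡ cycleAt E x x′ y′ y
  cycleAt-swapᴮ E x x′ y y′ =
    cong₂ _*_ (cong (λ q → b2n (not (x == x′)) * b2n (not q)) (==-sym y y′))
              (cong₂ _*_ (*-comm (adj E x y) (adj E x y′)) (*-comm (adj E x′ y) (adj E x′ y′)))

  module _ (E : BipGraph a b) (x₀ : Fin a) (y₀ : Fin b) where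

    private
      survives : Fin a → Fin b → ℕ
      survives x y = b2n (not (x == x₀ ∧ y == y₀))

      avoidsAll hitCount : Fin a → Fin a → Fin b → Fin b → ℕ
      avoidsAll x x′ y y′ = survives x y * survives x y′ * (survives x′ y * survives x′ y′)
      hitCount x x′ y y′ =
        b2n (x == x₀) * b2n (y == y₀) + b2n (x == x₀) * b2n (y′ == y₀)
          + (b2n (x′ == x₀) * b2n (y == y₀) + b2n (x′ == x₀) * b2n (y′ == y₀))

    hits : Fin a → Fin a → Fin b → Fin b → ℕ
    hits x x′ y y′ = onEdge x₀ y₀ x y c + onEdge x₀ y₀ x y′ c + (onEdge x₀ y₀ x′ y c + onEdge x₀ y₀ x′ y′ c)
      where c = cycleAt E x x′ y y′

    -- A 4-cycle of E either avoids x₀ y₀ (and survives) or uses it as exactly one of its four edges.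
    cycleAt-partition : ∀ x x′ y y′ →
      cycleAt E x x′ y y′ * (avoidsAll x x′ y y′ + hitCount x x′ y y′) ≡ cycleAt E x x′ y y′
    cycleAt-partition x x′ y y′ with x ≟ᶠ x′ | y ≟ᶠ y′
    ... | yes refl | _        = refl
    ... | no _     | yes refl = refl
    ... | no x≢x′  | no y≢y′  =
      trans (cong (c *_) (survivors+hits≡1 (x == x₀) (x′ == x₀) (y == y₀) (y′ == y₀)
                                             (==-exclusive x₀ x≢x′) (==-exclusive y₀ y≢y′)))
            (*-identityʳ c)
      where c = 1 * 1 * (adj E x y * adj E x y′ * (adj E x′ y * adj E x′ y′))

    cycleAt-removeEdge : ∀ x x′ y y′ →
      cycleAt (removeEdge E x₀ y₀) x x′ y y′ + hits x x′ y y′ ≡ cycleAt E x x′ y y′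
    cycleAt-removeEdge x x′ y y′ =
      trans (cong₂ _+_ (cong (d₁ * d₂ *_) (cong₂ _*_ (cong₂ _*_ (adj-removeEdge x y) (adj-removeEdge x y′))
                                                      (cong₂ _*_ (adj-removeEdge x′ y) (adj-removeEdge x′ y′))))
                       refl)
            (trans (regroup d₁ d₂ (adj E x y) (adj E x y′) (adj E x′ y) (adj E x′ y′)
                            (survives x y) (survives x y′) (survives x′ y) (survives x′ y′)
                            (b2n (x == x₀)) (b2n (x′ == x₀)) (b2n (y == y₀)) (b2n (y′ == y₀)))
                   (cycleAt-partition x x′ y y′))
      where
      d₁ = b2n (not (x == x′))
      d₂ = b2n (not (y == y′))
      adj-removeEdge : ∀ x y → adj (removeEdge E x₀ y₀) x y ≡ adj E x y * survives x y
      adj-removeEdge x y = b2n-∧ (E x y) _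
      regroup : ∀ d₁ d₂ e₁ e₂ e₃ e₄ s₁ s₂ s₃ s₄ p p′ q q′ →
        d₁ * d₂ * (e₁ * s₁ * (e₂ * s₂) * (e₃ * s₃ * (e₄ * s₄)))
          + (p * (q * (d₁ * d₂ * (e₁ * e₂ * (e₃ * e₄)))) + p * (q′ * (d₁ * d₂ * (e₁ * e₂ * (e₃ * e₄))))
             + (p′ * (q * (d₁ * d₂ * (e₁ * e₂ * (e₃ * e₄)))) + p′ * (q′ * (d₁ * d₂ * (e₁ * e₂ * (e₃ * e₄))))))
        ≡ d₁ * d₂ * (e₁ * e₂ * (e₃ * e₄)) * (s₁ * s₂ * (s₃ * s₄) + (p * q + p * q′ + (p′ * q + p′ * q′)))
      regroup = solve-∀

    cycles-removeEdge : cycles (removeEdge E x₀ y₀) + 4 * cyclesThrough E x₀ y₀ ≡ cycles E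
    cycles-removeEdge = begin
      cycles E′ + 4 * T                       ≡⟨ cong (cycles E′ +_) (four-times T) ⟩
      cycles E′ + (T + T + (T + T))           ≡⟨ cong (cycles E′ +_) hits≡ ⟨
      cycles E′ + Σ₄ hits                     ≡⟨ Σ₄-distrib-+ (cycleAt E′) hits ⟨
      Σ₄ (λ x x′ y y′ → cycleAt E′ x x′ y y′ + hits x x′ y y′)
                                              ≡⟨ Σ₄-cong cycleAt-removeEdge ⟩
      cycles E                                ∎
      where
      open ≡-Reasoning
      E′ = removeEdge E x₀ y₀
      T = cyclesThrough E x₀ y₀
      c = cycleAt E

      four-times : ∀ t → 4 * t ≡ t + t + (t + t)
      four-times = solve-∀

      on-x-y : Σ₄ (λ x x′ y y′ → onEdge x₀ y₀ x y (c x x′ y y′)) ≡ T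
      on-x-y = Σ₄-δ x₀ y₀ c

      on-x-y′ : Σ₄ (λ x x′ y y′ → onEdge x₀ y₀ x y′ (c x x′ y y′)) ≡ T
      on-x-y′ = trans (Σ₄-swapᴮ _)
        (trans (Σ₄-cong λ x x′ y y′ → cong (onEdge x₀ y₀ x y) (cycleAt-swapᴮ E x x′ y′ y)) on-x-y)

      on-x′-y : Σ₄ (λ x x′ y y′ → onEdge x₀ y₀ x′ y (c x x′ y y′)) ≡ T
      on-x′-y = trans (Σ₄-swapᴬ _)
        (trans (Σ₄-cong λ x x′ y y′ → cong (onEdge x₀ y₀ x y) (cycleAt-swapᴬ E x′ x y y′)) on-x-y)

      on-x′-y′ : Σ₄ (λ x x′ y y′ → onEdge x₀ y₀ x′ y′ (c x x′ y y′)) ≡ T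
      on-x′-y′ = trans (Σ₄-swapᴬ _) (trans (Σ₄-swapᴮ _)
        (trans (Σ₄-cong λ x x′ y y′ → cong (onEdge x₀ y₀ x y)
                 (trans (cycleAt-swapᴬ E x′ x y′ y) (cycleAt-swapᴮ E x x′ y′ y))) on-x-y))

      hits≡ : Σ₄ hits ≡ T + T + (T + T)
      hits≡ = trans (Σ₄-distrib-+ _ _)
        (cong₂ _+_ (trans (Σ₄-distrib-+ _ _) (cong₂ _+_ on-x-y on-x-y′))
                   (trans (Σ₄-distrib-+ _ _) (cong₂ _+_ on-x′-y on-x′-y′)))

  edges-removeEdge : ∀ E (x₀ : Fin a) (y₀ : Fin b) → E x₀ y₀ ≡ true →
                     edges E ≡ suc (edges (removeEdge E x₀ y₀))
  edges-removeEdge E x₀ y₀ x₀y₀∈E = begin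
    edges E
      ≡⟨ sumFin-cong a (λ x → sumFin-cong b λ y → b2n-split (E x y) (x == x₀) (y == y₀)) ⟩
    (sumFin a λ x → sumFin b λ y → adj E′ x y + onEdge x₀ y₀ x y (adj E x y))
      ≡⟨ trans (sumFin-cong a λ x → sumFin-distrib-+ b _ _) (sumFin-distrib-+ a _ _) ⟩
    edges E′ + (sumFin a λ x → sumFin b λ y → onEdge x₀ y₀ x y (adj E x y))
      ≡⟨ cong (edges E′ +_) (trans (sumFin₂-δ a b x₀ y₀ (adj E)) (cong b2n x₀y₀∈E)) ⟩
    edges E′ + 1
      ≡⟨ +-comm (edges E′) 1 ⟩
    suc (edges E′) ∎
    where
    open ≡-Reasoning
    E′ = removeEdge E x₀ y₀
    b2n-split : ∀ e p q → b2n e ≡ b2n (e ∧ not (p ∧ q)) + b2n p * (b2n q * b2n e)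
    b2n-split true  true  true  = refl
    b2n-split true  true  false = refl
    b2n-split true  false q     = refl
    b2n-split false true  true  = refl
    b2n-split false true  false = refl
    b2n-split false false q     = refl

  cyclesThrough-nonEdge : ∀ E x y → E x y ≡ false → cyclesThrough E x y ≡ 0
  cyclesThrough-nonEdge E x y xy∉E =
    trans (sumFin-cong a λ x′ → sumFin-cong b λ y′ → vanishes x′ y′)
          (trans (sumFin-cong a λ _ → sumFin-zero b) (sumFin-zero a))
    where
    vanishes : ∀ x′ y′ → cycleAt E x x′ y y′ ≡ 0
    vanishes x′ y′ rewrite xy∉E = *-zeroʳ (b2n (not (x == x′)) * b2n (not (y == y′)))

  cyclesThrough≤ : ∀ E x y t → cyclesThrough E x y ≤ t → cyclesThrough E x y ≤ adj E x y * t
  cyclesThrough≤ E x y t bound = by-cases (E x y) refl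
    where
    by-cases : ∀ e → E x y ≡ e → cyclesThrough E x y ≤ b2n e * t
    by-cases true  _     = subst (cyclesThrough E x y ≤_) (sym (+-identityʳ t)) bound
    by-cases false xy∉E = ≤-reflexive (cyclesThrough-nonEdge E x y xy∉E)

  cyclesThrough-pos⇒edge : ∀ E x y → 0 < cyclesThrough E x y → E x y ≡ true
  cyclesThrough-pos⇒edge E x y pos =
    b2n*-pos (cyclesThrough E x y) (<-≤-trans pos (cyclesThrough≤ E x y _ ≤-refl))

  heaviest-edge : ∀ E → 0 < cycles E →
    ∃[ x₀ ] ∃[ y₀ ] E x₀ y₀ ≡ true × cycles E ≤ edges E * cyclesThrough E x₀ y₀
  heaviest-edge E pos =
    let x , Tx>0 = sumFin-pos a _ (subst (0 <_) (Σ₄-byEdge (cycleAt E)) pos)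
        y , Txy>0 = sumFin-pos b _ Tx>0
        x₀ , y₀ , heaviest = argmax₂ (cyclesThrough E) x y
        T₀ = cyclesThrough E x₀ y₀
    in x₀ , y₀ , cyclesThrough-pos⇒edge E x₀ y₀ (<-≤-trans Txy>0 (heaviest x y)) , (begin
         cycles E
           ≡⟨ Σ₄-byEdge (cycleAt E) ⟩
         (sumFin a λ x → sumFin b λ y → cyclesThrough E x y)
           ≤⟨ sumFin-mono a (λ x → sumFin-mono b λ y → cyclesThrough≤ E x y T₀ (heaviest x y)) ⟩
         (sumFin a λ x → sumFin b λ y → adj E x y * T₀)
           ≡⟨ trans (*-distribʳ-sumFin a T₀ _) (sumFin-cong a λ x → *-distribʳ-sumFin b T₀ (adj E x)) ⟨
         edges E * T₀ ∎)
    where open ≤-Reasoning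

  ≤-Σ₄ : ∀ f x x′ y y′ → f x x′ y y′ ≤ Σ₄ f
  ≤-Σ₄ f x x′ y y′ =
    ≤-trans (≤-sumFin b _ y′) (≤-trans (≤-sumFin b _ y) (≤-trans (≤-sumFin a _ x′) (≤-sumFin a _ x)))

  cycles≡0⇒C4Free : ∀ E → cycles E ≡ 0 → C4Free E
  cycles≡0⇒C4Free E none (x , x′ , y , y′ , x≢x′ , y≢y′ , xy , xy′ , x′y , x′y′) =
    contradiction (≤-trans (≤-reflexive (sym is-cycle)) (≤-trans (≤-Σ₄ (cycleAt E) x x′ y y′) (≤-reflexive none)))
                  (λ ())
    where
    is-cycle : cycleAt E x x′ y y′ ≡ 1
    is-cycle rewrite dec-false (x ≟ᶠ x′) x≢x′ | dec-false (y ≟ᶠ y′) y≢y′ | xy | xy′ | x′y | x′y′ = refl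

  -- Count the cycles by their path y x y′ and the common neighbour x′ of y and y′.
  cycles≤ : ∀ E N K → (∀ x → degA E x ≤ N) → (∀ y y′ → y ≢ y′ → codegB E y y′ ≤ K) →
            cycles E ≤ edges E * (N * K)
  cycles≤ E N K deg≤ codeg≤ = begin
    cycles E
      ≡⟨ trans (Σ₄-byEdge _) (sumFin-cong a λ x → sumFin-cong b λ y → sumFin-comm a b _) ⟩
    (sumFin a λ x → sumFin b λ y → sumFin b λ y′ → sumFin a λ x′ → cycleAt E x x′ y y′)
      ≤⟨ sumFin-mono a (λ x → sumFin-mono b λ y → sumFin-mono b λ y′ → sumFin-mono a λ x′ →
           drop-x≠x′ x x′ y y′) ⟩
    (sumFin a λ x → sumFin b λ y → sumFin b λ y′ → sumFin a λ x′ → path x y y′ * (adj E x′ y * adj E x′ y′))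
      ≡⟨ sumFin-cong a (λ x → sumFin-cong b λ y → sumFin-cong b λ y′ →
           trans (sym (*-distribˡ-sumFin a (path x y y′) _))
                 (cong (path x y y′ *_) (sumFin-cong a λ x′ → sym (b2n-∧ (E x′ y) (E x′ y′))))) ⟩
    (sumFin a λ x → sumFin b λ y → sumFin b λ y′ → path x y y′ * codegB E y y′)
      ≤⟨ sumFin-mono a (λ x → sumFin-mono b λ y → sumFin-mono b λ y′ → path*codeg≤ x y y′) ⟩
    (sumFin a λ x → sumFin b λ y → sumFin b λ y′ → adj E x y * (adj E x y′ * K))
      ≡⟨ sumFin-cong a (λ x → trans (sumFin-cong b λ y →
           trans (sym (*-distribˡ-sumFin b (adj E x y) _)) (cong (adj E x y *_) (sym (*-distribʳ-sumFin b K (adj E x)))))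
           (sym (*-distribʳ-sumFin b (degA E x * K) (adj E x)))) ⟩
    (sumFin a λ x → degA E x * (degA E x * K))
      ≤⟨ sumFin-mono a (λ x → *-monoʳ-≤ (degA E x) (*-monoˡ-≤ K (deg≤ x))) ⟩
    (sumFin a λ x → degA E x * (N * K))
      ≡⟨ *-distribʳ-sumFin a (N * K) (degA E) ⟨
    edges E * (N * K) ∎
    where
    open ≤-Reasoning
    path : Fin a → Fin b → Fin b → ℕ
    path x y y′ = b2n (not (y == y′)) * (adj E x y * adj E x y′)

    drop-x≠x′ : ∀ x x′ y y′ → cycleAt E x x′ y y′ ≤ path x y y′ * (adj E x′ y * adj E x′ y′)
    drop-x≠x′ x x′ y y′ =
      ≤-trans (≤-reflexive (regroup (b2n (not (x == x′))) (b2n (not (y == y′)))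
                                    (adj E x y) (adj E x y′) (adj E x′ y) (adj E x′ y′)))
              (b2n*≤ (not (x == x′)) _)
      where
      regroup : ∀ d₁ d₂ e₁ e₂ e₃ e₄ → d₁ * d₂ * (e₁ * e₂ * (e₃ * e₄)) ≡ d₁ * (d₂ * (e₁ * e₂) * (e₃ * e₄))
      regroup = solve-∀

    path*codeg≤ : ∀ x y y′ → path x y y′ * codegB E y y′ ≤ adj E x y * (adj E x y′ * K)
    path*codeg≤ x y y′ with y ≟ᶠ y′
    ... | yes _   = z≤n
    ... | no y≢y′ = ≤-trans (≤-reflexive (regroup (adj E x y) (adj E x y′) (codegB E y y′)))
                            (*-monoʳ-≤ (adj E x y) (*-monoʳ-≤ (adj E x y′) (codeg≤ y y′ y≢y′)))
      where
      regroup : ∀ e₁ e₂ c → 1 * (e₁ * e₂) * c ≡ e₁ * (e₂ * c)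
      regroup = solve-∀

-- h is at least s − q (s)₄/(e)₄ for every s ≤ e: a random s-set of the e edges contains a given 4-cycle
-- with probability (s)₄/(e)₄. The case s = e is stated separately since (e)₄ = 0 for e < 4.
Retains : (e h q : ℕ) → Set
Retains e h q = e ≤ h + q × (∀ s → s ≤ e → s * (e P′ 4) ≤ h * (e P′ 4) + q * (s P′ 4))

retains-refl : ∀ e → Retains e e 0
retains-refl e =
  ≤-reflexive (sym (+-identityʳ e)) ,
  λ s s≤e → ≤-trans (*-monoˡ-≤ (e P′ 4) s≤e) (≤-reflexive (sym (+-identityʳ _)))

P′4-suc : ∀ k → (5 + k) * ((4 + k) P′ 4) ≡ (1 + k) * ((5 + k) P′ 4)
P′4-suc k = expanded k
  where
  expanded : ∀ k → (5 + k) * ((1 + k) * ((2 + k) * ((3 + k) * ((4 + k) * 1))))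
                   ≡ (1 + k) * ((2 + k) * ((3 + k) * ((4 + k) * ((5 + k) * 1))))
  expanded = solve-∀

retains-suc : ∀ k s h q′ q →
  s * ((4 + k) P′ 4) ≤ h * ((4 + k) P′ 4) + q′ * (s P′ 4) → (5 + k) * q′ ≤ (1 + k) * q →
  s * ((5 + k) P′ 4) ≤ h * ((5 + k) P′ 4) + q * (s P′ 4)
retains-suc k s h q′ q bound q′≤ = *-cancelˡ-≤ (1 + k) (begin
  (1 + k) * (s * P₅)             ≡⟨ rotate (1 + k) s P₅ ⟩
  s * ((1 + k) * P₅)             ≡⟨ cong (s *_) (P′4-suc k) ⟨
  s * ((5 + k) * P₄)             ≡⟨ rotate s (5 + k) P₄ ⟩
  (5 + k) * (s * P₄)             ≤⟨ *-monoʳ-≤ (5 + k) bound ⟩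
  (5 + k) * (h * P₄ + q′ * Pₛ)   ≡⟨ expand (5 + k) h P₄ q′ Pₛ ⟩
  h * ((5 + k) * P₄) + (5 + k) * q′ * Pₛ
                                 ≤⟨ +-mono-≤ (≤-reflexive (cong (h *_) (P′4-suc k))) (*-monoˡ-≤ Pₛ q′≤) ⟩
  h * ((1 + k) * P₅) + (1 + k) * q * Pₛ
                                 ≡⟨ expand (1 + k) h P₅ q Pₛ ⟨
  (1 + k) * (h * P₅ + q * Pₛ)    ∎)
  where
  open ≤-Reasoning
  P₄ = (4 + k) P′ 4
  P₅ = (5 + k) P′ 4
  Pₛ = s P′ 4
  rotate : ∀ m n p → m * (n * p) ≡ n * (m * p)
  rotate = solve-∀
  expand : ∀ m h p q r → m * (h * p + q * r) ≡ h * (m * p) + m * q * r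
  expand = solve-∀

retains-below : ∀ j {s h q′ q} → Retains j h q′ → suc j * q′ + 4 * q ≤ suc j * q → s ≤ j →
                s * (suc j P′ 4) ≤ h * (suc j P′ 4) + q * (s P′ 4)
retains-below 0 {s} _ _ _ = ≤-trans (≤-reflexive (*-zeroʳ s)) z≤n
retains-below 1 {s} _ _ _ = ≤-trans (≤-reflexive (*-zeroʳ s)) z≤n
retains-below 2 {s} _ _ _ = ≤-trans (≤-reflexive (*-zeroʳ s)) z≤n
-- Here (s)₄ = 0, and the key inequality forces q′ = 0.
retains-below 3 {s} {h} {q′} {q} (3≤h+q′ , _) key s≤3 =
  ≤-trans (*-monoˡ-≤ 24 (≤-trans s≤3 3≤h)) (m≤m+n (h * 24) _)
  where
  q′≡0 : q′ ≡ 0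
  q′≡0 = n≤0⇒n≡0 (*-cancelˡ-≤ 4 (+-cancelʳ-≤ (4 * q) (4 * q′) 0 key))
  3≤h : 3 ≤ h
  3≤h = subst (3 ≤_) (trans (cong (h +_) q′≡0) (+-identityʳ h)) 3≤h+q′
retains-below (suc (suc (suc (suc k)))) {s} {h} {q′} {q} (_ , bound) key s≤j =
  retains-suc k s h q′ q (bound s s≤j) (+-cancelʳ-≤ (4 * q) _ _ (subst ((5 + k) * q′ + 4 * q ≤_) (split k q) key))
  where
  split : ∀ k q → (5 + k) * q ≡ (1 + k) * q + 4 * q
  split = solve-∀

retains-step : ∀ {j h q′ q} → Retains j h q′ → 0 < q → suc j * q′ + 4 * q ≤ suc j * q →
               Retains (suc j) h q
retains-step {j} {h} {q′} {q} retains@(j≤h+q′ , _) q>0 key = sj≤h+q , bound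
  where
  q′<q : q′ < q
  q′<q = *-cancelˡ-< (suc j) q′ q (<-≤-trans (m<m+n (suc j * q′) (<-≤-trans q>0 (m≤m+n q _))) key)
  sj≤h+q : suc j ≤ h + q
  sj≤h+q = ≤-trans (s≤s j≤h+q′) (≤-trans (≤-reflexive (sym (+-suc h q′))) (+-monoʳ-≤ h q′<q))
  bound : ∀ s → s ≤ suc j → s * (suc j P′ 4) ≤ h * (suc j P′ 4) + q * (s P′ 4)
  bound s s≤ with m≤n⇒m<n∨m≡n s≤
  ... | inj₂ refl       = ≤-trans (*-monoˡ-≤ (suc j P′ 4) sj≤h+q) (≤-reflexive (*-distribʳ-+ (suc j P′ 4) h q))
  ... | inj₁ (s≤s s≤j) = retains-below j {h = h} {q′} retains key s≤j

deletion-key : ∀ n q′ w q → q′ + 4 * w ≡ q → q ≤ n * w → n * q′ + 4 * q ≤ n * q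
deletion-key n q′ w q q′+4w≡q q≤nw = begin
  n * q′ + 4 * q         ≤⟨ +-monoʳ-≤ (n * q′) (*-monoʳ-≤ 4 q≤nw) ⟩
  n * q′ + 4 * (n * w)   ≡⟨ factor n q′ w ⟩
  n * (q′ + 4 * w)       ≡⟨ cong (n *_) q′+4w≡q ⟩
  n * q                  ∎
  where
  open ≤-Reasoning
  factor : ∀ n q′ w → n * q′ + 4 * (n * w) ≡ n * (q′ + 4 * w)
  factor = solve-∀

module _ {a b : ℕ} where

  Thinning : BipGraph a b → Set
  Thinning E = Σ[ H ∈ BipGraph a b ] H ⊆ E × C4Free H × Retains (edges E) (edges H) (cycles E)

  -- The deleted edge lies on at least a 1/e share of the labelled 4-cycles, which is exactly what
  -- retains-step needs to keep the guarantee while e drops by one.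
  thin : ∀ j (E : BipGraph a b) → edges E ≡ j → Thinning E
  thin j E eE with cycles E in q≡
  ... | zero = E , (λ _ _ → id) , cycles≡0⇒C4Free E q≡ , retains-refl (edges E)
  ... | suc q with heaviest-edge E (subst (0 <_) (sym q≡) z<s)
  thin zero    E eE | suc q | x₀ , y₀ , x₀y₀∈E , heaviest =
    ⊥-elim (0≢1+n (trans (sym eE) (edges-removeEdge E x₀ y₀ x₀y₀∈E)))
  thin (suc j) E eE | suc q | x₀ , y₀ , x₀y₀∈E , heaviest
    with thin j (removeEdge E x₀ y₀) (suc-injective (trans (sym (edges-removeEdge E x₀ y₀ x₀y₀∈E)) eE))
  ... | H , H⊆E′ , H-C4Free , retains =
    H , (λ x y → ∧-conicalˡ (E x y) _ ∘ H⊆E′ x y) , H-C4Free ,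
    subst (λ e → Retains e (edges H) (suc q)) (sym edges≡) (retains-step retains z<s key)
    where
    E′ = removeEdge E x₀ y₀
    edges≡ = edges-removeEdge E x₀ y₀ x₀y₀∈E
    key : suc (edges E′) * cycles E′ + 4 * suc q ≤ suc (edges E′) * suc q
    key = deletion-key (suc (edges E′)) (cycles E′) (cyclesThrough E x₀ y₀) (suc q)
            (trans (cycles-removeEdge E x₀ y₀) q≡)
            (subst₂ (λ c e → c ≤ e * cyclesThrough E x₀ y₀) q≡ edges≡ heaviest)

crossing : ∀ {P : ℕ → Set} → Decidable P → ¬ P 0 → ∀ n → P n → ∃[ t ] ¬ P t × P (suc t)
crossing P? ¬P0 zero    P0  = ⊥-elim (¬P0 P0)
crossing P? ¬P0 (suc n) Psn with P? n
... | yes Pn = crossing P? ¬P0 n Pn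
... | no ¬Pn = n , ¬Pn , Psn

^-cancelʳ-≤ : ∀ n .{{_ : NonZero n}} {m o} → m ^ n ≤ o ^ n → m ≤ o
^-cancelʳ-≤ n mⁿ≤oⁿ = ≮⇒≥ (λ o<m → <⇒≱ (^-monoˡ-< n o<m) mⁿ≤oⁿ)

∸-ratio : ∀ k {s e} → s ≤ e → (s ∸ k) * e ≤ s * (e ∸ k)
∸-ratio k {s} {e} s≤e = begin
  (s ∸ k) * e       ≡⟨ *-distribʳ-∸ e s k ⟩
  s * e ∸ k * e     ≤⟨ ∸-monoʳ-≤ (s * e) (≤-trans (≤-reflexive (*-comm s k)) (*-monoʳ-≤ k s≤e)) ⟩
  s * e ∸ s * k     ≡⟨ *-distribˡ-∸ s e k ⟨
  s * (e ∸ k)       ∎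
  where open ≤-Reasoning

P′-ratio : ∀ k {s e} → s ≤ e → (s P′ k) * e ^ k ≤ s ^ k * (e P′ k)
P′-ratio zero    s≤e = ≤-refl
P′-ratio (suc k) {s} {e} s≤e = begin
  (s ∸ k) * (s P′ k) * (e * e ^ k)     ≡⟨ interchange (s ∸ k) (s P′ k) e (e ^ k) ⟩
  (s ∸ k) * e * ((s P′ k) * e ^ k)     ≤⟨ *-mono-≤ (∸-ratio k s≤e) (P′-ratio k s≤e) ⟩
  s * (e ∸ k) * (s ^ k * (e P′ k))     ≡⟨ interchange s (e ∸ k) (s ^ k) (e P′ k) ⟩
  s * s ^ k * ((e ∸ k) * (e P′ k))     ∎
  where
  open ≤-Reasoning
  interchange : ∀ a b c d → a * b * (c * d) ≡ a * c * (b * d)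
  interchange = solve-∀

-- s is the least number with 4e² ≤ s²N, that is s = ⌈2e/√N⌉.
sample-size : ∀ {N e} → 16 ≤ N → N < e * e →
              ∃[ s ] s ≤ e × 4 * (e * e) ≤ s * s * N × s * s * N < 16 * (e * e)
sample-size {N} {e} 16≤N N<e² with crossing (λ s → 4 * (e * e) ≤? s * s * N) ¬P0 (2 * e) P2e
  where
  ¬P0 : ¬ (4 * (e * e) ≤ 0)
  ¬P0 P0 = n≮0 (<-≤-trans N<e² (≤-trans (m≤n*m (e * e) 4) P0))
  P2e : 4 * (e * e) ≤ 2 * e * (2 * e) * N
  P2e = ≤-trans (m≤m*n (4 * (e * e)) N {{>-nonZero (≤-trans (s≤s z≤n) 16≤N)}})
                (≤-reflexive (square-double e N))
    where
    square-double : ∀ e N → 4 * (e * e) * N ≡ 2 * e * (2 * e) * N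
    square-double = solve-∀
... | zero , _ , P1 =
  ⊥-elim (<⇒≱ N<e² (≤-trans (m≤n*m (e * e) 4) (≤-trans P1 (≤-reflexive (+-identityʳ N)))))
... | suc t , ¬Pt , Ps = suc (suc t) , s≤e , Ps , s²N<16e²
  where
  s = suc (suc t)
  s²N<16e² : s * s * N < 16 * (e * e)
  s²N<16e² = begin-strict
    s * s * N                   ≤⟨ m≤m+n (s * s * N) _ ⟩
    s * s * N + (3 * (t * t) + 4 * t) * N
                                ≡⟨ square-succ t N ⟩
    4 * (suc t * suc t * N)     <⟨ *-monoʳ-< 4 (≰⇒> ¬Pt) ⟩
    4 * (4 * (e * e))           ≡⟨ *-assoc 4 4 (e * e) ⟨
    16 * (e * e)                ∎
    where
    open ≤-Reasoning
    square-succ : ∀ t N → (2 + t) * (2 + t) * N + (3 * (t * t) + 4 * t) * N ≡ 4 * ((1 + t) * (1 + t) * N)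
    square-succ = solve-∀
  s≤e : s ≤ e
  s≤e = ≮⇒≥ λ e<s → <⇒≱ s²N<16e²
          (≤-trans (≤-reflexive (*-comm 16 (e * e))) (*-mono-≤ (*-mono-≤ (<⇒≤ e<s) (<⇒≤ e<s)) 16≤N))

-- 16384 = 4 · 16³ is the constant sampled-cycles needs.
codegree-root-bound : ∀ {N K} → 2 ^ 24 ≤ N → K ^ 5 ≤ N → 16384 * (K * K) ≤ N
codegree-root-bound {N} {K} 2²⁴≤N K⁵≤N = ^-cancelʳ-≤ 5 (begin
  (16384 * (K * K)) ^ 5        ≡⟨ expand 16384 K ⟩
  16384 ^ 5 * (K ^ 5 * K ^ 5)  ≤⟨ *-monoʳ-≤ (16384 ^ 5) (*-mono-≤ K⁵≤N K⁵≤N) ⟩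
  16384 ^ 5 * (N * N)          ≤⟨ *-monoˡ-≤ (N * N) (≤-trans (≤ᵇ⇒≤ (16384 ^ 5) ((2 ^ 24) ^ 3) _) (^-monoˡ-≤ 3 2²⁴≤N)) ⟩
  N ^ 3 * (N * N)              ≡⟨ collect N ⟩
  N ^ 5                        ∎)
  where
  open ≤-Reasoning
  expand : ∀ c K → (c * (K * K)) ^ 5 ≡ c ^ 5 * (K ^ 5 * K ^ 5)
  expand c K = trans (^-distrib-* c (K * K) 5) (cong (c ^ 5 *_) (^-distrib-* K K 5))
  collect : ∀ N → N * (N * (N * 1)) * (N * N) ≡ N * (N * (N * (N * (N * 1))))
  collect = solve-∀

sampled-cycles : ∀ {N K e q s} .{{_ : NonZero N}} .{{_ : NonZero e}} →
  16384 * (K * K) ≤ N → q ≤ e * (N * K) → s ≤ e → s * s * N < 16 * (e * e) →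
  2 * (q * (s P′ 4)) ≤ s * (e P′ 4)
sampled-cycles {N} {K} {e} {q} {s} K²≤N q≤eNK s≤e s²N<16e² =
  *-cancelˡ-≤ (e * e * e) {{m*n≢0 (e * e) e {{m*n≢0 e e}}}} (begin
    e * e * e * (2 * (q * Pₛ))              ≤⟨ *-monoʳ-≤ (e * e * e) (*-monoʳ-≤ 2 (*-monoˡ-≤ Pₛ q≤eNK)) ⟩
    e * e * e * (2 * (e * (N * K) * Pₛ))    ≡⟨ pull-e e N K Pₛ ⟩
    2 * (N * K) * (Pₛ * e ^ 4)              ≤⟨ *-monoʳ-≤ (2 * (N * K)) (P′-ratio 4 s≤e) ⟩
    2 * (N * K) * (s ^ 4 * Pₑ)              ≡⟨ split-s N K s Pₑ ⟩
    2 * (N * K) * (s * s * s) * (s * Pₑ)    ≤⟨ *-monoˡ-≤ (s * Pₑ) 2NKs³≤e³ ⟩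
    e * e * e * (s * Pₑ)                    ∎)
  where
  open ≤-Reasoning
  Pₛ = s P′ 4
  Pₑ = e P′ 4
  pull-e : ∀ e N K p → e * e * e * (2 * (e * (N * K) * p)) ≡ 2 * (N * K) * (p * (e * (e * (e * (e * 1)))))
  pull-e = solve-∀
  split-s : ∀ N K s p → 2 * (N * K) * (s * (s * (s * (s * 1))) * p) ≡ 2 * (N * K) * (s * s * s) * (s * p)
  split-s = solve-∀
  2NKs³≤e³ : 2 * (N * K) * (s * s * s) ≤ e * e * e
  2NKs³≤e³ = ^-cancelʳ-≤ 2 (*-cancelˡ-≤ N (begin
    N * (2 * (N * K) * (s * s * s)) ^ 2      ≡⟨ cube-of-s²N N K s ⟩
    4 * (K * K) * (s²N * s²N * s²N)          ≤⟨ *-monoʳ-≤ (4 * (K * K)) (*-mono-≤ (*-mono-≤ s²N≤ s²N≤) s²N≤) ⟩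
    4 * (K * K) * (16e² * 16e² * 16e²)       ≡⟨ cube-of-e² 16 K e ⟩
    4 * 16 * 16 * 16 * (K * K) * (e * e * e) ^ 2
                                             ≤⟨ *-monoˡ-≤ ((e * e * e) ^ 2) K²≤N ⟩
    N * (e * e * e) ^ 2                      ∎))
    where
    s²N = s * s * N
    16e² = 16 * (e * e)
    s²N≤ : s²N ≤ 16e²
    s²N≤ = <⇒≤ s²N<16e²
    cube-of-s²N : ∀ N K s → N * ((2 * (N * K) * (s * s * s)) * ((2 * (N * K) * (s * s * s)) * 1))
                            ≡ 4 * (K * K) * ((s * s * N) * (s * s * N) * (s * s * N))
    cube-of-s²N = solve-∀
    cube-of-e² : ∀ c K e → 4 * (K * K) * ((c * (e * e)) * (c * (e * e)) * (c * (e * e)))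
                           ≡ 4 * c * c * c * (K * K) * ((e * e * e) * ((e * e * e) * 1))
    cube-of-e² = solve-∀

P′4-pos : ∀ {e} → 4 ≤ e → 0 < e P′ 4
P′4-pos (s≤s (s≤s (s≤s (s≤s _)))) = z<s

retained-density : ∀ {N K e h q} → 2 ^ 24 ≤ N → K ^ 5 ≤ N → q ≤ e * (N * K) → N < e * e →
                   Retains e h q → e * e ≤ N * (h * h)
retained-density {N} {K} {e} {h} {q} 2²⁴≤N K⁵≤N q≤eNK N<e² (_ , retains) =
  let s , s≤e , 4e²≤s²N , s²N<16e² = sample-size 16≤N N<e²
      sPₑ≤2hPₑ = halve {s} {e P′ 4} {h} {q * (s P′ 4)} (retains s s≤e)
                   (sampled-cycles {{N≢0}} {{e≢0}} (codegree-root-bound {N} {K} 2²⁴≤N K⁵≤N) q≤eNK s≤e s²N<16e²)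
      s≤2h = *-cancelʳ-≤ s (2 * h) (e P′ 4) {{>-nonZero (P′4-pos 4≤e)}} sPₑ≤2hPₑ
  in *-cancelˡ-≤ 4 (begin
       4 * (e * e)                ≤⟨ 4e²≤s²N ⟩
       s * s * N                  ≤⟨ *-monoˡ-≤ N (*-mono-≤ s≤2h s≤2h) ⟩
       2 * h * (2 * h) * N        ≡⟨ square-double h N ⟩
       4 * (N * (h * h))          ∎)
  where
  open ≤-Reasoning
  16≤N : 16 ≤ N
  16≤N = ≤-trans (≤ᵇ⇒≤ 16 (2 ^ 24) _) 2²⁴≤N
  N≢0 : NonZero N
  N≢0 = >-nonZero (≤-trans (s≤s z≤n) 16≤N)
  4≤e : 4 ≤ e
  4≤e = ≮⇒≥ λ e<4 → <⇒≱ N<e² (≤-trans (*-mono-≤ (<⇒≤ e<4) (<⇒≤ e<4)) 16≤N)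
  e≢0 : NonZero e
  e≢0 = >-nonZero (≤-trans (s≤s z≤n) 4≤e)
  halve : ∀ {s p h r} → s * p ≤ h * p + r → 2 * r ≤ s * p → s * p ≤ 2 * h * p
  halve {s} {p} {h} {r} sp≤hp+r 2r≤sp = +-cancelʳ-≤ (s * p) (s * p) (2 * h * p) (begin
    s * p + s * p              ≡⟨ +-*-double (s * p) ⟩
    2 * (s * p)                ≤⟨ *-monoʳ-≤ 2 sp≤hp+r ⟩
    2 * (h * p + r)            ≡⟨ *-distribˡ-+ 2 (h * p) r ⟩
    2 * (h * p) + 2 * r        ≤⟨ +-monoʳ-≤ (2 * (h * p)) 2r≤sp ⟩
    2 * (h * p) + s * p        ≡⟨ cong (_+ s * p) (*-assoc 2 h p) ⟨
    2 * h * p + s * p          ∎)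
    where
    +-*-double : ∀ n → n + n ≡ 2 * n
    +-*-double = solve-∀
  square-double : ∀ h N → 2 * h * (2 * h) * N ≡ 4 * (N * (h * h))
  square-double = solve-∀

fifth-root : ∀ N → ∃[ K ] K ^ 5 ≤ N × N < suc K ^ 5
fifth-root N =
  let K , N≮K⁵ , N<sK⁵ = crossing (λ k → N <? k ^ 5) n≮0 (suc N)
                           (<-≤-trans (n<1+n N) (m≤m*n (suc N) (suc N ^ 4) {{m^n≢0 (suc N) 4}}))
  in K , ≮⇒≥ N≮K⁵ , N<sK⁵

module _ {a b : ℕ} where

  singleEdge : Fin a → Fin b → BipGraph a b
  singleEdge x₀ y₀ x y = x == x₀ ∧ y == y₀

  singleEdge⊆ : ∀ {G : BipGraph a b} {x₀ y₀} → G x₀ y₀ ≡ true → singleEdge x₀ y₀ ⊆ G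
  singleEdge⊆ {G} x₀y₀∈G x y xy∈H
    rewrite ==⇒≡ {i = x} (∧-conicalˡ _ _ xy∈H) | ==⇒≡ {i = y} (∧-conicalʳ (x == _) _ xy∈H) = x₀y₀∈G

  singleEdge-C4Free : ∀ x₀ y₀ → C4Free (singleEdge x₀ y₀)
  singleEdge-C4Free x₀ y₀ (x , x′ , y , _ , x≢x′ , _ , xy , _ , x′y , _) =
    x≢x′ (trans (==⇒≡ (∧-conicalˡ _ _ xy)) (sym (==⇒≡ (∧-conicalˡ _ _ x′y))))

  edges-singleEdge : ∀ x₀ y₀ → edges (singleEdge x₀ y₀) ≡ 1
  edges-singleEdge x₀ y₀ =
    trans (sumFin-cong a λ x → sumFin-cong b λ y →
            trans (b2n-∧ (x == x₀) (y == y₀)) (cong (b2n (x == x₀) *_) (sym (*-identityʳ _))))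
          (sumFin₂-δ a b x₀ y₀ (λ _ _ → 1))

  sparse-C4-free-subgraph : ∀ (G : BipGraph a b) N → edges G * edges G ≤ N →
    Σ[ H ∈ BipGraph a b ] H ⊆ G × C4Free H × edges G * edges G ≤ N * (edges H * edges H)
  sparse-C4-free-subgraph G N e²≤N with edges G in eG
  ... | zero  = (λ _ _ → false) , (λ _ _ ()) , (λ { (_ , _ , _ , _ , _ , _ , () , _) }) , z≤n
  ... | suc _ =
    let x₀ , pos = sumFin-pos a _ (subst (0 <_) (sym eG) z<s)
        y₀ , pos′ = sumFin-pos b _ pos
    in singleEdge x₀ y₀ , singleEdge⊆ (b2n*-pos 1 (subst (0 <_) (sym (*-identityʳ _)) pos′)) ,
       singleEdge-C4Free x₀ y₀ ,
       subst (λ e → _ ≤ N * (e * e)) (sym (edges-singleEdge x₀ y₀)) (≤-trans e²≤N (≤-reflexive (sym (*-identityʳ N))))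

  C4-free-subgraph : ∀ (G : BipGraph a b) N → 2 ^ 24 ≤ N → (∀ x → degA G x ≤ N) →
    (∀ y y′ → y ≢ y′ → codegB G y y′ ^ 5 ≤ N) →
    Σ[ H ∈ BipGraph a b ] H ⊆ G × C4Free H × edges G * edges G ≤ N * (edges H * edges H)
  C4-free-subgraph G N 2²⁴≤N deg≤N codeg⁵≤N with N <? edges G * edges G
  ... | no N≮e² = sparse-C4-free-subgraph G N (≮⇒≥ N≮e²)
  ... | yes N<e² with thin _ G refl | fifth-root N
  ...   | H , H⊆G , H-C4Free , retains | K , K⁵≤N , N<[K+1]⁵ =
    H , H⊆G , H-C4Free , retained-density 2²⁴≤N K⁵≤N (cycles≤ G N K deg≤N codeg≤K) N<e² retains
    where
    codeg≤K : ∀ y y′ → y ≢ y′ → codegB G y y′ ≤ K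
    codeg≤K y y′ y≢y′ = ≮⇒≥ λ K<c → <⇒≱ N<[K+1]⁵ (≤-trans (^-monoˡ-≤ 5 K<c) (codeg⁵≤N y y′ y≢y′))

ℕ→ℚ-normal : ∀ n → ℕ→ℚ n ≡ mkℚ (ℤ.+ n) 0 (Coprime.sym (1-coprimeTo n))
ℕ→ℚ-normal n = ℚP.normalize-coprime (Coprime.sym (1-coprimeTo n))

ℕ→ℚ-* : ∀ m n → ℕ→ℚ (m * n) ≡ ℕ→ℚ m *q ℕ→ℚ n
ℕ→ℚ-* m n = trans (cong (ℚ._/ 1) (ℤP.pos-* m n)) (sym (cong₂ _*q_ (ℕ→ℚ-normal m) (ℕ→ℚ-normal n)))

ℕ→ℚ-^ : ∀ m k → ℕ→ℚ (m ^ k) ≡ ℕ→ℚ m ^q k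
ℕ→ℚ-^ m zero    = refl
ℕ→ℚ-^ m (suc k) = trans (ℕ→ℚ-* m (m ^ k)) (cong (ℕ→ℚ m *q_) (ℕ→ℚ-^ m k))

ℕ→ℚ-mono-≤ : ∀ {m n} → m ≤ n → ℕ→ℚ m ≤q ℕ→ℚ n
ℕ→ℚ-mono-≤ {m} {n} m≤n rewrite ℕ→ℚ-normal m | ℕ→ℚ-normal n =
  *≤* (subst₂ ℤ._≤_ (sym (ℤP.*-identityʳ (ℤ.+ m))) (sym (ℤP.*-identityʳ (ℤ.+ n))) (ℤ.+≤+ m≤n))

ℕ→ℚ-nonNeg : ∀ n → NonNegative (ℕ→ℚ n)
ℕ→ℚ-nonNeg n rewrite ℕ→ℚ-normal n = _

ℕ→ℚ-pos : ∀ n → Positive (ℕ→ℚ (suc n))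
ℕ→ℚ-pos n rewrite ℕ→ℚ-normal (suc n) = _

module _ {p q : ℕ} .{c : Coprime p (suc q)} where

  ℕ→ℚ≤⇒*≤ : ∀ m → ℕ→ℚ m ≤q mkℚ (ℤ.+ p) q c → m * suc q ≤ p
  ℕ→ℚ≤⇒*≤ m m≤d rewrite ℕ→ℚ-normal m with m≤d
  ... | *≤* m*q≤p = ℤP.drop‿+≤+ (subst₂ ℤ._≤_ (sym (ℤP.pos-* m (suc q))) (ℤP.*-identityʳ (ℤ.+ p)) m*q≤p)

  *≤⇒ℕ→ℚ≤ : ∀ m → m * suc q ≤ p → ℕ→ℚ m ≤q mkℚ (ℤ.+ p) q c
  *≤⇒ℕ→ℚ≤ m m*q≤p rewrite ℕ→ℚ-normal m =
    *≤* (subst₂ ℤ._≤_ (ℤP.pos-* m (suc q)) (sym (ℤP.*-identityʳ (ℤ.+ p))) (ℤ.+≤+ m*q≤p))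

ℕ→ℚ≰negative : ∀ m {p q} .{c : Coprime (suc p) (suc q)} → ¬ (ℕ→ℚ m ≤q mkℚ ℤ.-[1+ p ] q c)
ℕ→ℚ≰negative m {p} {q} m≤d rewrite ℕ→ℚ-normal m with m≤d
... | *≤* m*q≤-p with subst₂ ℤ._≤_ (sym (ℤP.pos-* m (suc q))) (ℤP.*-identityʳ ℤ.-[1+ p ]) m*q≤-p
...   | ()

ℚ-floor : ∀ {m} d → ℕ→ℚ m ≤q d → ∃[ N ] ℕ→ℚ N ≤q d × (∀ n → ℕ→ℚ n ≤q d → n ≤ N)
ℚ-floor {m} (mkℚ ℤ.-[1+ p ] q c) m≤d = ⊥-elim (ℕ→ℚ≰negative m m≤d)
ℚ-floor     (mkℚ (ℤ.+ p) q c)    _   =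
  p / suc q , *≤⇒ℕ→ℚ≤ (p / suc q) (m/n*n≤m p (suc q)) ,
  λ n n≤d → subst (_≤ p / suc q) (m*n/n≡m n (suc q)) (/-monoˡ-≤ (suc q) (ℕ→ℚ≤⇒*≤ n n≤d))

density-transfer : ∀ d .{{_ : Positive d}} N v e h → ℕ→ℚ N ≤q d → e * e ≤ N * (h * h) →
  (d ^q 3) *q (ℕ→ℚ v ^q 4) ≤q ℕ→ℚ (2 * e) ^q 4 → d *q (ℕ→ℚ v ^q 4) ≤q ℕ→ℚ (2 * h) ^q 4
density-transfer d N v e h N≤d e²≤Nh² dense = ℚP.*-cancelˡ-≤-pos (d *q d) {{ℚP.pos*pos⇒pos d d}} (begin
  d *q d *q (d *q V)               ≡⟨ cube d V ⟩
  (d ^q 3) *q V                    ≤⟨ dense ⟩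
  ℕ→ℚ (2 * e) ^q 4                 ≡⟨ ℕ→ℚ-^ (2 * e) 4 ⟨
  ℕ→ℚ ((2 * e) ^ 4)                ≤⟨ ℕ→ℚ-mono-≤ (fourth-powers {N} {e} {h} e²≤Nh²) ⟩
  ℕ→ℚ (N * N * (2 * h) ^ 4)        ≡⟨ trans (ℕ→ℚ-* (N * N) _) (cong₂ _*q_ (ℕ→ℚ-* N N) (ℕ→ℚ-^ (2 * h) 4)) ⟩
  ℕ→ℚ N *q ℕ→ℚ N *q H              ≤⟨ ℚP.*-monoʳ-≤-nonNeg H {{H-nonNeg}}
                                        (ℚP.≤-trans (ℚP.*-monoʳ-≤-nonNeg (ℕ→ℚ N) {{ℕ→ℚ-nonNeg N}} N≤d)
                                                    (ℚP.*-monoˡ-≤-nonNeg d {{ℚP.pos⇒nonNeg d}} N≤d)) ⟩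
  d *q d *q H                      ∎)
  where
  open ℚP.≤-Reasoning
  V = ℕ→ℚ v ^q 4
  H = ℕ→ℚ (2 * h) ^q 4
  H-nonNeg : NonNegative H
  H-nonNeg = subst NonNegative (ℕ→ℚ-^ (2 * h) 4) (ℕ→ℚ-nonNeg ((2 * h) ^ 4))
  cube : ∀ d V → d *q d *q (d *q V) ≡ (d ^q 3) *q V
  cube d V = trans (sym (ℚP.*-assoc (d *q d) d V))
                   (cong (_*q V) (trans (ℚP.*-assoc d d d) (cong (λ z → d *q (d *q z)) (sym (ℚP.*-identityʳ d)))))
  fourth-powers : ∀ {N e h} → e * e ≤ N * (h * h) → (2 * e) ^ 4 ≤ N * N * (2 * h) ^ 4
  fourth-powers {N} {e} {h} e²≤Nh² =
    subst₂ _≤_ (sym (expand-e e)) (sym (expand-h N h)) (*-monoʳ-≤ 16 (*-mono-≤ e²≤Nh² e²≤Nh²))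
    where
    expand-e : ∀ e → (2 * e) * ((2 * e) * ((2 * e) * ((2 * e) * 1))) ≡ 16 * ((e * e) * (e * e))
    expand-e = solve-∀
    expand-h : ∀ N h → N * N * ((2 * h) * ((2 * h) * ((2 * h) * ((2 * h) * 1))))
                       ≡ 16 * ((N * (h * h)) * (N * (h * h)))
    expand-h = solve-∀

positive-above : ∀ {n d} .{{_ : NonZero n}} → ℕ→ℚ n ≤q d → Positive d
positive-above {suc n} n≤d = ℚ.positive (ℚP.<-≤-trans (ℚP.positive⁻¹ (ℕ→ℚ (suc n)) {{ℕ→ℚ-pos n}}) n≤d)

module _ {a b : ℕ} {G : BipGraph a b} where

  spanning : ∀ {H} → H ⊆ G → Subgraph G
  spanning {H} H⊆G = record { VA = λ _ → true ; VB = λ _ → true ; F = H ; F⊆G = H⊆G ; F⊆V = λ _ _ _ → refl , refl }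

  vertsH-spanning : ∀ {H} (H⊆G : H ⊆ G) → vertsH (spanning H⊆G) ≡ a + b
  vertsH-spanning _ = cong₂ _+_ (sumFin-one a) (sumFin-one b)

lemma2p4 : Σ ℕ λ d₀ → (d : ℚ) → ℕ→ℚ d₀ ≤q d →
    (a b : ℕ) → b ≤ a → 0 < a + b → (G : BipGraph a b) →
    (∀ (y y' : Fin b) → y ≢ y' → (ℕ→ℚ (codegB G y y') ^q 5) ≤q d) →
    (∀ (x : Fin a) → ℕ→ℚ (degA G x) ≤q d) →
    (d ^q 3) *q (ℕ→ℚ (a + b) ^q 4) ≤q ℕ→ℚ (2 * edges G) ^q 4 →
    Σ (Subgraph G) λ H →
      C4Free (F H) × 0 < vertsH H ×
      d *q (ℕ→ℚ (vertsH H) ^q 4) ≤q ℕ→ℚ (2 * edgesH H) ^q 4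
lemma2p4 .proj₁ = 2 ^ 24
lemma2p4 .proj₂ d 2²⁴≤d a b _ a+b>0 G codeg⁵≤d deg≤d dense =
  let N , N≤d , ≤N = ℚ-floor {2 ^ 24} d 2²⁴≤d
      H , H⊆G , H-C4Free , e²≤Nh² =
        C4-free-subgraph G N (≤N (2 ^ 24) 2²⁴≤d) (λ x → ≤N (degA G x) (deg≤d x))
          (λ y y′ y≢y′ → ≤N (codegB G y y′ ^ 5) (subst (_≤q d) (sym (ℕ→ℚ-^ (codegB G y y′) 5)) (codeg⁵≤d y y′ y≢y′)))
  in spanning H⊆G , H-C4Free , subst (0 <_) (sym (vertsH-spanning H⊆G)) a+b>0 ,
     subst (λ v → d *q (ℕ→ℚ v ^q 4) ≤q ℕ→ℚ (2 * edges H) ^q 4) (sym (vertsH-spanning H⊆G))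
           (density-transfer d {{positive-above {2 ^ 24} 2²⁴≤d}} N (a + b) (edges G) (edges H) N≤d e²≤Nh² dense)
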